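{- Let $\mathcal{F}=\{S_1,\dots,S_m\}$ be a family of sets, let $u$ be a new element not contained in any $S_i$, let $E_i=S_i\cup\{u\}$ for each $i$, and let $\mathcal{S}=\bigcup_{i=1}^m E_i$. Let $H$ be the hypergraph with vertex set $\mathcal{S}$ and hyperedge family $\{E_1,\dots,E_m\}\cup\{\mathcal{S}\}$ (where $\mathcal{S}$ is an additional hyperedge). Then $\mathcal{F}$ contains two distinct sets $S_i$ and $S_j$ ($i\neq j$) with $S_i\subseteq S_j$ if and only if there is a join tree for $H$ that contains the edge $E_iE_j$.
   Context: A join tree for a hypergraph is a tree whose nodes are its hyperedges such that, for every vertex $v$, the hyperedges containing $v$ induce a connected subtree. (Note $H$ is acyclic: the star with center $\mathcal{S}$ and leaves $E_1,\dots,E_m$ is a join tree.) -}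

module Defs where

open import Data.Nat using (ℕ; suc; _≤_)
open import Data.Fin using (Fin; zero; suc)
open import Data.Maybe using (Maybe; just; nothing)
open import Data.List using (List; []; _∷_; length; _∷ʳ_)
open import Data.List.Relation.Unary.Unique.Propositional using (Unique)
open import Data.List.Relation.Unary.Linked using (Linked)
open import Data.Product using (Σ; ∃; _×_)
open import Data.Unit using (⊤)
open import Data.Empty using (⊥)
open import Relation.Binary.PropositionalEquality using (_≡_)
open import Relation.Nullary using (¬_)
open import Relation.Unary using (Pred)
open import Level using (0ℓ)

record Graph (k : ℕ) : Set₁ where
  field
    Adj   : Fin k → Fin k → Set
    sym   : ∀ {x y} → Adj x y → Adj y x
    irrefl : ∀ {x} → ¬ Adj x x
open Graph public

data WalkIn {k : ℕ} (G : Graph k) (P : Fin k → Set) : Fin k → Fin k → Set where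
  here : ∀ {x} → P x → WalkIn G P x x
  step : ∀ {x z y} → P x → Adj G x z → WalkIn G P z y → WalkIn G P x y

Connected : {k : ℕ} → Graph k → Set
Connected G = ∀ x y → WalkIn G (λ _ → ⊤) x y

Cycle : {k : ℕ} → Graph k → Set
Cycle {k} G = Σ (Fin k) λ x → Σ (List (Fin k)) λ vs →
  (2 ≤ length vs) × Unique (x ∷ vs) × Linked (Adj G) (x ∷ (vs ∷ʳ x))

IsTree : {k : ℕ} → Graph k → Set
IsTree G = Connected G × ¬ Cycle G

-- The hypergraph H built from a family S₁,…,Sₘ of subsets of A.
-- Vertices live in Maybe A; the new element u is `nothing`.
-- Hyperedge nodes are Fin (suc m): node zero is 𝒮, node (suc i) is Eᵢ.

module _ {A : Set} {m : ℕ} (S : Fin m → Pred A 0ℓ) where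

  InE : Fin m → Maybe A → Set
  InE i nothing  = ⊤
  InE i (just a) = S i a

  In𝒮 : Maybe A → Set
  In𝒮 v = ∃ λ i → InE i v

  InNode : Fin (suc m) → Maybe A → Set
  InNode zero    v = In𝒮 v
  InNode (suc i) v = InE i v

  IsJoinTree : Graph (suc m) → Set
  IsJoinTree T = IsTree T ×
    (∀ v → In𝒮 v → ∀ x y → InNode x v → InNode y v →
       WalkIn T (λ z → InNode z v) x y)

-- If Sᵢ ⊆ Sⱼ, hang Eᵢ below Eⱼ and every other Eₖ below 𝒮: only 𝒮 and Eⱼ
-- have two neighbours, so this is a tree, and since Eᵢ ⊆ Eⱼ every vertex
-- occurring in Eᵢ can reach 𝒮 through Eⱼ. Conversely, let EᵢEⱼ be an edge
-- of a join tree and say 𝒮 lies on Eⱼ's side of it. An element α of Sᵢ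
-- lies in Eᵢ and in 𝒮, so the hyperedges containing α connect Eᵢ to 𝒮;
-- a connection avoiding Eⱼ would close, with the path from Eⱼ to 𝒮, a
-- closed walk through the edge EᵢEⱼ, and loop erasure turns it into a cycle.
-- Hence α ∈ Eⱼ, i.e. Sᵢ ⊆ Sⱼ.
module Submission where

open import Defs
open import Data.Nat using (ℕ; suc; _≤_; s≤s)
open import Data.Nat.Properties using (≤-refl; m≤n⇒m≤1+n)
open import Data.Fin using (Fin; suc; zero)
open import Data.Fin.Properties using (_≟_)
open import Data.Product using (Σ; ∃; ∃₂; _×_; _,_; proj₁; proj₂)
open import Data.Sum using (_⊎_; inj₁; inj₂; [_,_]′)
open import Data.Unit using (tt)
open import Data.Empty using (⊥; ⊥-elim)
open import Data.Maybe using (just; nothing)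
open import Data.List using (List; []; _∷_; _++_; _∷ʳ_; length)
open import Data.List.Relation.Unary.All using (All; []; _∷_)
open import Data.List.Relation.Unary.AllPairs using ([]; _∷_)
open import Data.List.Relation.Unary.Unique.Propositional using (Unique)
open import Data.List.Relation.Unary.Linked using (Linked; []; [-]; _∷_)
import Data.List.Relation.Unary.Linked as Linked
open import Relation.Binary.Core using (Rel)
open import Relation.Binary.Definitions using (DecidableEquality)
open import Relation.Binary.PropositionalEquality using (_≡_; _≢_; refl; ≢-sym)
open import Relation.Nullary using (¬_; yes; no)
open import Relation.Nullary.Decidable using (_⊎-dec_)
open import Relation.Unary using (Pred; Decidable; ∁; _⊆_)
open import Level using (0ℓ)
open import Function using (_∘_)
open import Function.Bundles using (_⇔_; mk⇔)

data Suffix {A : Set} : List A → List A → Set where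
  here  : ∀ {L} → Suffix L L
  there : ∀ {L x M} → Suffix L M → Suffix L (x ∷ M)

module _ {A : Set} where

  Suffix-length : ∀ {L M : List A} → Suffix L M → length L ≤ length M
  Suffix-length here      = ≤-refl
  Suffix-length (there s) = m≤n⇒m≤1+n (Suffix-length s)

  Unique-suffix : ∀ {L M : List A} → Suffix L M → Unique M → Unique L
  Unique-suffix here      u       = u
  Unique-suffix (there s) (_ ∷ u) = Unique-suffix s u

  Linked-suffix : ∀ {ℓ} {R : Rel A ℓ} {L M ys : List A} →
    Suffix L M → Linked R (M ++ ys) → Linked R (L ++ ys)
  Linked-suffix here      l = l
  Linked-suffix (there s) l = Linked-suffix s (Linked.tail l)

  suffix-at : DecidableEquality A → (w : A) (L : List A) →
    All (w ≢_) L ⊎ ∃ λ L₁ → Suffix (w ∷ L₁) L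
  suffix-at _≟_ w [] = inj₁ []
  suffix-at _≟_ w (x ∷ L) with w ≟ x | suffix-at _≟_ w L
  ... | yes refl | _               = inj₂ (L , here)
  ... | no w≢x   | inj₁ w∉L        = inj₁ (w≢x ∷ w∉L)
  ... | no _     | inj₂ (L₁ , s)   = inj₂ (L₁ , there s)

  suffix-keeps-end : ∀ {w p a : A} {L₁ M} → Suffix (w ∷ L₁) M →
    Suffix (p ∷ a ∷ []) M → w ≢ a → Suffix (p ∷ a ∷ []) (w ∷ L₁)
  suffix-keeps-end here              s₂         _   = s₂
  suffix-keeps-end (there here)      here       w≢a = ⊥-elim (w≢a refl)
  suffix-keeps-end (there (there ())) here      _
  suffix-keeps-end (there s₁)        (there s₂) w≢a = suffix-keeps-end s₁ s₂ w≢a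

module Walk {k : ℕ} (G : Graph k) where

  head : ∀ {P x y} → WalkIn G P x y → P x
  head (here p)     = p
  head (step p _ _) = p

  map : ∀ {P Q : Fin k → Set} → (∀ {v} → P v → Q v) →
    ∀ {x y} → WalkIn G P x y → WalkIn G Q x y
  map f (here p)     = here (f p)
  map f (step p e w) = step (f p) e (map f w)

  infixr 5 _++ʷ_
  _++ʷ_ : ∀ {P x y z} → WalkIn G P x y → WalkIn G P y z → WalkIn G P x z
  here _     ++ʷ w′ = w′
  step p e w ++ʷ w′ = step p e (w ++ʷ w′)

  reverse : ∀ {P x y} → WalkIn G P x y → WalkIn G P y x
  reverse (here p)     = here p
  reverse (step p e w) = reverse w ++ʷ step (head w) (sym G e) (here p)

  through-or-avoid : ∀ {P x z} (y : Fin k) → WalkIn G P x z →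
    P y ⊎ WalkIn G (_≢ y) x z
  through-or-avoid y (here {x} p) with x ≟ y
  ... | yes refl = inj₁ p
  ... | no x≢y   = inj₂ (here x≢y)
  through-or-avoid y (step {x} p e w) with x ≟ y | through-or-avoid y w
  ... | yes refl | _       = inj₁ p
  ... | no _     | inj₁ py = inj₁ py
  ... | no x≢y   | inj₂ w′ = inj₂ (step x≢y e w′)

  module _ {D : Pred (Fin k) 0ℓ} (D? : Decidable D) where

    Exit : Fin k → Set
    Exit z = ∃₂ λ u w → D u × Adj G u w × WalkIn G (∁ D) w z

    avoid-or-exit : ∀ {P x z} → ¬ D z → WalkIn G P x z →
      WalkIn G (∁ D) x z ⊎ Exit z
    avoid-or-exit ¬Dz (here _) = inj₁ (here ¬Dz)
    avoid-or-exit ¬Dz (step {x} {y} _ e w) with avoid-or-exit ¬Dz w | D? x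
    ... | inj₂ exit | _       = inj₂ exit
    ... | inj₁ w′   | yes Dx  = inj₂ (x , y , Dx , e , w′)
    ... | inj₁ w′   | no ¬Dx  = inj₁ (step ¬Dx e w′)

    last-exit : ∀ {P x z} → D x → ¬ D z → WalkIn G P x z → Exit z
    last-exit Dx ¬Dz w with avoid-or-exit ¬Dz w
    ... | inj₁ w′   = ⊥-elim (head w′ Dx)
    ... | inj₂ exit = exit

  -- A trail at c is a simple path a, p, …, c (stored from c back to a)
  -- that closes up into a cycle through the edge c b and the edge a b.
  module Erasure (a b p : Fin k) where

    record Trail (c : Fin k) : Set where
      field
        back   : List (Fin k)
        unique : Unique (c ∷ back)
        linked : Linked (Adj G) ((c ∷ back) ∷ʳ b)
        rooted : Suffix (p ∷ a ∷ []) (c ∷ back)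
    open Trail public

    extend : ∀ {c w} → Trail c → Adj G c w → w ≢ a → Trail w
    extend {c} {w} t e w≢a with suffix-at _≟_ w (c ∷ back t)
    ... | inj₁ w∉ = record
      { back   = c ∷ back t
      ; unique = w∉ ∷ unique t
      ; linked = sym G e ∷ linked t
      ; rooted = there (rooted t)
      }
    ... | inj₂ (L₁ , s) = record
      { back   = L₁
      ; unique = Unique-suffix s (unique t)
      ; linked = Linked-suffix s (linked t)
      ; rooted = suffix-keeps-end s (rooted t) w≢a
      }

    erase : ∀ {c t} → Trail c → WalkIn G (_≢ a) c t → Trail t
    erase tr (here _)     = tr
    erase tr (step _ e w) = erase (extend tr e (head w)) w

  detour-cycle : ∀ {a b p} → Adj G a b → Adj G p a → p ≢ b →
    WalkIn G (_≢ a) p b → Cycle G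
  detour-cycle {a} {b} {p} ab pa p≢b w =
    b , back end , length≥2 (rooted end) , unique end , linked end
    where
      open Erasure a b p

      start : Trail p
      start = record
        { back   = a ∷ []
        ; unique = (head w ∷ []) ∷ [] ∷ []
        ; linked = pa ∷ ab ∷ [-]
        ; rooted = here
        }

      end : Trail b
      end = erase start w

      length≥2 : ∀ {L} → Suffix (p ∷ a ∷ []) (b ∷ L) → 2 ≤ length L
      length≥2 here      = ⊥-elim (p≢b refl)
      length≥2 (there s) = Suffix-length s

-- Three distinct nodes of a cycle each have two distinct neighbours on it.
two-hubs⇒acyclic : ∀ {k} (G : Graph k) (h₁ h₂ : Fin k) →
  (∀ {a b c} → Adj G a b → Adj G b c → a ≢ c → b ≡ h₁ ⊎ b ≡ h₂) → ¬ Cycle G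
two-hubs⇒acyclic {k} G h₁ h₂ hub = no-cycle
  where
    Hub : Fin k → Set
    Hub v = v ≡ h₁ ⊎ v ≡ h₂

    pigeonhole : ∀ {x y z} → Hub x → Hub y → Hub z → x ≢ y → x ≢ z → y ≢ z → ⊥
    pigeonhole (inj₁ refl) (inj₁ refl) _           x≢y _   _   = x≢y refl
    pigeonhole (inj₂ refl) (inj₂ refl) _           x≢y _   _   = x≢y refl
    pigeonhole (inj₁ refl) (inj₂ refl) (inj₁ refl) _   x≢z _   = x≢z refl
    pigeonhole (inj₂ refl) (inj₁ refl) (inj₂ refl) _   x≢z _   = x≢z refl
    pigeonhole (inj₁ refl) (inj₂ refl) (inj₂ refl) _   _   y≢z = y≢z refl
    pigeonhole (inj₂ refl) (inj₁ refl) (inj₁ refl) _   _   y≢z = y≢z refl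

    successor : ∀ {v x r} vs → Linked (Adj G) (r ∷ (vs ∷ʳ x)) →
      All (v ≢_) vs → v ≢ x → ∃ λ n → Adj G r n × v ≢ n
    successor {x = x} [] (e ∷ [-]) _ v≢x = x , e , v≢x
    successor (n ∷ _) (e ∷ _) (v≢n ∷ _) _ = n , e , v≢n

    no-cycle : ¬ Cycle G
    no-cycle (x , [] , () , _)
    no-cycle (x , _ ∷ [] , s≤s () , _)
    no-cycle (x , v₁ ∷ v₂ ∷ [] , _ , ((x≢v₁ ∷ x≢v₂ ∷ []) ∷ (v₁≢v₂ ∷ []) ∷ _) ,
         (xv₁ ∷ v₁v₂ ∷ v₂x ∷ [-])) =
      pigeonhole (hub v₂x xv₁ (≢-sym v₁≢v₂)) (hub xv₁ v₁v₂ x≢v₂)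
        (hub v₁v₂ v₂x (≢-sym x≢v₁)) x≢v₁ x≢v₂ v₁≢v₂
    no-cycle (x , v₁ ∷ v₂ ∷ v₃ ∷ vs , _ ,
         ((_ ∷ x≢v₂ ∷ _) ∷ (v₁≢v₂ ∷ v₁≢v₃ ∷ _) ∷ (v₂≢v₃ ∷ v₂∉vs) ∷ _) ,
         (xv₁ ∷ v₁v₂ ∷ v₂v₃ ∷ l)) =
      let n , v₃n , v₂≢n = successor vs l v₂∉vs (≢-sym x≢v₂) in
      pigeonhole (hub xv₁ v₁v₂ x≢v₂) (hub v₁v₂ v₂v₃ v₁≢v₃) (hub v₂v₃ v₃n v₂≢n)
        v₁≢v₂ v₁≢v₃ v₂≢v₃

module _ {A : Set} {m : ℕ} (S : Fin m → Pred A 0ℓ) {T : Graph (suc m)}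
         (jt : IsJoinTree S T) where
  open Walk T

  𝒮-on-Eⱼ-side⇒⊆ : ∀ {i j w} → Adj T (suc i) (suc j) → Adj T (suc j) w →
    w ≢ suc i → WalkIn T (_≢ suc j) w zero → S i ⊆ S j
  𝒮-on-Eⱼ-side⇒⊆ {i} {j} ij jw w≢i w⇝𝒮 {α} α∈Sᵢ
    with through-or-avoid (suc j) (proj₂ jt (just α) (i , α∈Sᵢ) (suc i) zero α∈Sᵢ (i , α∈Sᵢ))
  ... | inj₁ α∈Sⱼ = α∈Sⱼ
  ... | inj₂ Eᵢ⇝𝒮 =
    ⊥-elim (proj₂ (proj₁ jt) (detour-cycle (sym T ij) (sym T jw) w≢i (w⇝𝒮 ++ʷ reverse Eᵢ⇝𝒮)))

  joinTree-edge⇒⊆ : ∀ {i j} → Adj T (suc i) (suc j) → S i ⊆ S j ⊎ S j ⊆ S i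
  joinTree-edge⇒⊆ {i} {j} ij
    with last-exit (λ u → u ≟ suc i ⊎-dec u ≟ suc j) (inj₁ refl)
                   (λ { (inj₁ ()) ; (inj₂ ()) }) (proj₁ (proj₁ jt) (suc i) zero)
  ... | _ , w , inj₁ refl , iw , w⇝𝒮 =
    inj₂ (𝒮-on-Eⱼ-side⇒⊆ (sym T ij) iw (head w⇝𝒮 ∘ inj₂) (map (_∘ inj₁) w⇝𝒮))
  ... | _ , w , inj₂ refl , jw , w⇝𝒮 =
    inj₁ (𝒮-on-Eⱼ-side⇒⊆ ij jw (head w⇝𝒮 ∘ inj₁) (map (_∘ inj₂) w⇝𝒮))

module PendantStar {m : ℕ} {i j : Fin m} (i≢j : i ≢ j) where

  Edge : Fin (suc m) → Fin (suc m) → Set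
  Edge zero    (suc k) = k ≢ i
  Edge (suc k) (suc l) = k ≡ i × l ≡ j
  Edge _       _       = ⊥

  irreflexive : ∀ {x} → ¬ (Edge x x ⊎ Edge x x)
  irreflexive {zero}  (inj₁ ())
  irreflexive {zero}  (inj₂ ())
  irreflexive {suc _} (inj₁ (refl , refl)) = i≢j refl
  irreflexive {suc _} (inj₂ (refl , refl)) = i≢j refl

  tree : Graph (suc m)
  tree = record
    { Adj    = λ x y → Edge x y ⊎ Edge y x
    ; sym    = [ inj₂ , inj₁ ]′
    ; irrefl = irreflexive
    }

  neighbours : ∀ {a k} → Adj tree a (suc k) → k ≢ j →
    (a ≡ zero × k ≢ i) ⊎ (a ≡ suc j × k ≡ i)
  neighbours {zero}  (inj₁ k≢i)         _   = inj₁ (refl , k≢i)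
  neighbours {suc _} (inj₁ (_ , refl))  k≢j = ⊥-elim (k≢j refl)
  neighbours {suc _} (inj₂ (refl , refl)) _ = inj₂ (refl , refl)

  turn⇒hub : ∀ {a b c} → Adj tree a b → Adj tree b c → a ≢ c → b ≡ zero ⊎ b ≡ suc j
  turn⇒hub {b = zero} _ _ _ = inj₁ refl
  turn⇒hub {a} {suc k} {c} ab bc a≢c with k ≟ j
  ... | yes refl = inj₂ refl
  ... | no k≢j with neighbours ab k≢j | neighbours (sym tree bc) k≢j
  ... | inj₁ (refl , _)   | inj₁ (refl , _)   = ⊥-elim (a≢c refl)
  ... | inj₁ (_ , k≢i)    | inj₂ (_ , k≡i)    = ⊥-elim (k≢i k≡i)
  ... | inj₂ (_ , k≡i)    | inj₁ (_ , k≢i)    = ⊥-elim (k≢i k≡i)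
  ... | inj₂ (refl , _)   | inj₂ (refl , _)   = ⊥-elim (a≢c refl)

  walk-via-𝒮 : ∀ {P : Fin (suc m) → Set} → P zero → (P (suc i) → P (suc j)) →
    ∀ {x y} → P x → P y → WalkIn tree P x y
  walk-via-𝒮 {P} P𝒮 Pᵢ⇒Pⱼ Px Py = to𝒮 _ Px ++ʷ reverse (to𝒮 _ Py)
    where
      open Walk tree using (_++ʷ_; reverse)

      to𝒮 : ∀ x → P x → WalkIn tree P x zero
      to𝒮 zero    Px = here Px
      to𝒮 (suc k) Px with k ≟ i
      ... | yes refl = step Px (inj₁ (refl , refl)) (step (Pᵢ⇒Pⱼ Px) (inj₂ (≢-sym i≢j)) (here P𝒮))
      ... | no k≢i   = step Px (inj₂ k≢i) (here P𝒮)

  ⊆⇒joinTree : ∀ {A} (S : Fin m → Pred A 0ℓ) → S i ⊆ S j → IsJoinTree S tree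
  ⊆⇒joinTree S Sᵢ⊆Sⱼ =
    ((λ _ _ → walk-via-𝒮 tt (λ _ → tt) tt tt) , two-hubs⇒acyclic tree zero (suc j) turn⇒hub) ,
    (λ v v∈𝒮 _ _ → walk-via-𝒮 v∈𝒮 (Eᵢ⊆Eⱼ v))
    where
      Eᵢ⊆Eⱼ : ∀ v → InE S i v → InE S j v
      Eᵢ⊆Eⱼ nothing  _   = tt
      Eᵢ⊆Eⱼ (just _) α∈Sᵢ = Sᵢ⊆Sⱼ α∈Sᵢ

lemma1 : (A : Set) (m : ℕ) (S : Fin m → Pred A 0ℓ) →
    (Σ (Fin m) λ i → Σ (Fin m) λ j → (i ≢ j) × (S i ⊆ S j))
    ⇔
    (Σ (Fin m) λ i → Σ (Fin m) λ j → (i ≢ j) ×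
      Σ (Graph (suc m)) λ T → IsJoinTree S T × Adj T (suc i) (suc j))
lemma1 A m S = mk⇔
  (λ (i , j , i≢j , Sᵢ⊆Sⱼ) →
    i , j , i≢j , PendantStar.tree i≢j , PendantStar.⊆⇒joinTree i≢j S Sᵢ⊆Sⱼ , inj₁ (refl , refl))
  (λ (i , j , i≢j , T , jt , ij) →
    [ (λ Sᵢ⊆Sⱼ → i , j , i≢j , Sᵢ⊆Sⱼ) , (λ Sⱼ⊆Sᵢ → j , i , ≢-sym i≢j , Sⱼ⊆Sᵢ) ]′ (joinTree-edge⇒⊆ S jt ij))
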